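{- Let $G,H,H'$ be finite digraphs, $\xi\in\mathcal{H}(G,H)$ and $\sigma\in\mathcal{H}(H,H')$. Then $\Gamma_\xi(v)\subseteq\Gamma_{\sigma\circ\xi}(v)$ for all $v\in V(G)$, and equality holds for all $v\in V(G)$ if the restriction of $\sigma$ to $\xi[V(G)]$ is strict (i.e. $\sigma$ maps every proper arc of $H$ with both endpoints in $\xi[V(G)]$ to a proper arc of $H'$).
   Context: Digraphs $G=(V(G),A(G))$: finite non-empty $V(G)$, $A(G)\subseteq V(G)\times V(G)$; an arc $vw$ is proper if $v\ne w$. $\mathcal{H}(G,H)$: homomorphisms (maps with $\xi(v)\xi(w)\in A(H)$ for $vw\in A(G)$). $v,w$ adjacent if $vw$ or $wv$ is an arc. For $X\subseteq V(G)$, $v\in X$, $\gamma_X(v)$ = set of $w\in X$ equal to $v$ or joined to $v$ by a sequence in $X$ of consecutively adjacent vertices; for a map $\xi$ on $V(G)$, $\Gamma_\xi(v)=\gamma_{\xi^{ -1}(\xi(v))}(v)$. -}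

module Defs where

open import Data.Nat using (ℕ; suc)
open import Data.Fin using (Fin)
open import Data.Product using (_×_)
open import Data.Sum using (_⊎_)
open import Relation.Binary.PropositionalEquality using (_≡_)
open import Relation.Nullary using (¬_)

record Digraph : Set₁ where
  field
    pred-size : ℕ
    Arc       : Fin (suc pred-size) → Fin (suc pred-size) → Set

open Digraph public

V : Digraph → Set
V G = Fin (suc (pred-size G))

record Hom (G H : Digraph) : Set where
  field
    map      : V G → V H
    preserve : ∀ v w → Arc G v w → Arc H (map v) (map w)

open Hom public

Adjacent : (G : Digraph) → V G → V G → Set
Adjacent G v w = Arc G v w ⊎ Arc G w v

-- γ_X(v) membership: w ∈ γ_X(v) iff w = v or w is joined to v by a
-- sequence of consecutively adjacent vertices all lying in X.
-- (Used with v ∈ X.)  Reach G X v w : w is reachable from v within X.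
data Reach (G : Digraph) (X : V G → Set) (v : V G) : V G → Set where
  here : Reach G X v v
  step : ∀ {u w} → Reach G X v u → X u → X w → Adjacent G u w → Reach G X v w

γ : (G : Digraph) → (X : V G → Set) → V G → V G → Set
γ G X v w = X w × Reach G X v w

Γ : (G : Digraph) {B : Set} → (V G → B) → V G → V G → Set
Γ G ξ v = γ G (λ u → ξ u ≡ ξ v) v

_⊆_ : {A : Set} → (A → Set) → (A → Set) → Set
P ⊆ Q = ∀ x → P x → Q x

_≐_ : {A : Set} → (A → Set) → (A → Set) → Set
P ≐ Q = (P ⊆ Q) × (Q ⊆ P)

StrictOnImage : {G H H' : Digraph} → Hom G H → Hom H H' → Set
StrictOnImage {G} {H} ξ σ =
  ∀ (a b : V G) → ¬ (map ξ a ≡ map ξ b) → Arc H (map ξ a) (map ξ b) →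
    ¬ (map σ (map ξ a) ≡ map σ (map ξ b))

-- A path inside a fibre of σ ∘ ξ stays inside a fibre of ξ as long as σ never
-- identifies the ξ-images of two adjacent vertices; strictness of σ on the
-- image of ξ guarantees exactly that, because ξ maps arcs of G to arcs of H.
-- The converse inclusion holds for any σ, since fibres of ξ refine those of σ ∘ ξ.
module Submission where

open import Defs
open import Data.Product using (_×_; _,_)
open import Data.Sum using (inj₁; inj₂)
open import Data.Fin using (_≟_)
open import Function using (_∘_)
open import Relation.Nullary using (yes; no; contradiction)
open import Relation.Binary.PropositionalEquality using (_≡_; refl; sym; trans; cong)

Reach-mono : (G : Digraph) {X Y : V G → Set} → (∀ u → X u → Y u) →
  ∀ {v w} → Reach G X v w → Reach G Y v w
Reach-mono G X⊆Y here = here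
Reach-mono G X⊆Y (step r xu xw a) = step (Reach-mono G X⊆Y r) (X⊆Y _ xu) (X⊆Y _ xw) a

Γ-⊆-∘ : (G : Digraph) {B C : Set} (ξ : V G → B) (f : B → C) (v : V G) →
  Γ G ξ v ⊆ Γ G (f ∘ ξ) v
Γ-⊆-∘ G ξ f v w (ξw≡ξv , r) = cong f ξw≡ξv , Reach-mono G (λ _ → cong f) r

Separates-adjacent : (G : Digraph) {B C : Set} → (V G → B) → (B → C) → Set
Separates-adjacent G ξ f =
  ∀ u w → Adjacent G u w → f (ξ u) ≡ f (ξ w) → ξ u ≡ ξ w

module _ (G : Digraph) {B C : Set} (ξ : V G → B) (f : B → C)
         (separates : Separates-adjacent G ξ f) (v : V G) where

  Reach-∘⇒Reach : ∀ {w} → Reach G (λ u → f (ξ u) ≡ f (ξ v)) v w →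
    ξ w ≡ ξ v × Reach G (λ u → ξ u ≡ ξ v) v w
  Reach-∘⇒Reach here = refl , here
  Reach-∘⇒Reach (step {u} {w} r fξu≡ fξw≡ a) with Reach-∘⇒Reach r
  ... | ξu≡ξv , r′ = ξw≡ξv , step r′ ξu≡ξv ξw≡ξv a
    where
    ξw≡ξv : ξ w ≡ ξ v
    ξw≡ξv = trans (sym (separates u w a (trans fξu≡ (sym fξw≡)))) ξu≡ξv

  Γ-∘-⊆ : Γ G (f ∘ ξ) v ⊆ Γ G ξ v
  Γ-∘-⊆ w (_ , r) = Reach-∘⇒Reach r

StrictOnImage⇒Separates-adjacent : {G H H' : Digraph} (ξ : Hom G H) (σ : Hom H H') →
  StrictOnImage ξ σ → Separates-adjacent G (map ξ) (map σ)
StrictOnImage⇒Separates-adjacent ξ σ strict u w adj σξu≡σξw with map ξ u ≟ map ξ w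
... | yes ξu≡ξw = ξu≡ξw
... | no ξu≢ξw with adj
...   | inj₁ uw = contradiction σξu≡σξw (strict u w ξu≢ξw (preserve ξ u w uw))
...   | inj₂ wu = contradiction (sym σξu≡σξw)
                    (strict w u (ξu≢ξw ∘ sym) (preserve ξ w u wu))

corollary3 : (G H H' : Digraph) (ξ : Hom G H) (σ : Hom H H') →
    ((v : V G) → Γ G (map ξ) v ⊆ Γ G (map σ ∘ map ξ) v) ×
    (StrictOnImage ξ σ → (v : V G) → Γ G (map ξ) v ≐ Γ G (map σ ∘ map ξ) v)
corollary3 G H H' ξ σ = ⊆-∘ , λ strict v →
    ⊆-∘ v , Γ-∘-⊆ G (map ξ) (map σ) (StrictOnImage⇒Separates-adjacent ξ σ strict) v
  where
  ⊆-∘ : (v : V G) → Γ G (map ξ) v ⊆ Γ G (map σ ∘ map ξ) v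
  ⊆-∘ = Γ-⊆-∘ G (map ξ) (map σ)
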